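{- Let $\mathcal{H}$ be a pseudohalfplane hypergraph on $V$ with witnessing ABA-free hypergraph $\mathcal{F}$. If a topset $H\in\mathcal{H}$ contains two bottomvertices $p<q$ that are consecutive in the circular order of the extremal vertices, then $H$ contains every vertex $r$ with $p<r<q$. Symmetrically, if a bottomset $H\in\mathcal{H}$ contains two topvertices $p<q$ that are consecutive in the circular order of the extremal vertices, then $H$ contains every vertex $r$ with $p<r<q$.
   Context: Let $V=\{v_1<v_2<\dots<v_n\}$ be a finite totally ordered set. A hypergraph $\mathcal{F}$ on $V$ is ABA-free if there are no two hyperedges $A,B\in\mathcal{F}$ and vertices $x<y<z$ with $x,z\in A\setminus B$ and $y\in B\setminus A$. Let $\bar{\mathcal{F}}=\{V\setminus F: F\in\mathcal{F}\}$. $\mathcal{H}$ is a pseudohalfplane hypergraph if $\mathcal{H}\subseteq\mathcal{F}\cup\bar{\mathcal{F}}$ for some ABA-free $\mathcal{F}$ on $V$; fix such an $\mathcal{F}$. Hyperedges of $\mathcal{H}$ in $\mathcal{F}$ are topsets, those in $\bar{\mathcal{F}}$ are bottomsets. A vertex $a$ is skippable in a hypergraph $\mathcal{G}$ on $V$ if some $A\in\mathcal{G}$ has $\min(A)<a<\max(A)$ and $a\notin A$, and unskippable otherwise. Topvertices are the unskippable vertices of $\mathcal{F}$, bottomvertices are the unskippable vertices of $\bar{\mathcal{F}}$; $v_1$ and $v_n$ are both. The extremal vertices are the topvertices together with the bottomvertices. Let $t_1=v_1<t_2<\dots<t_k=v_n$ be the topvertices and $b_1=v_1<b_2<\dots<b_l=v_n$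 the bottomvertices. The circular order of the extremal vertices is the cyclic sequence $(v_1,t_2,\dots,t_{k-1},v_n,b_{l-1},\dots,b_2)$. -}

module Defs where

open import Data.Nat using (ℕ)
open import Data.Fin using (Fin; _<_)
open import Data.Fin.Subset using (Subset; _∈_; _∉_; ∁)
open import Data.List using (List; map)
import Data.List.Membership.Propositional as L
open import Data.Product using (_×_; ∃; ∃-syntax)
open import Data.Sum using (_⊎_)
open import Data.Empty using (⊥)
open import Relation.Nullary using (¬_)

-- The totally ordered vertex set V = {v_1 < ... < v_n} is Fin n with its usual order.
-- A hypergraph on V is a finite family (list) of subsets of V.
Hypergraph : ℕ → Set
Hypergraph n = List (Subset n)

_∈ₕ_ : ∀ {n} → Subset n → Hypergraph n → Set
A ∈ₕ ℱ = A L.∈ ℱ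

ABAFree : ∀ {n} → Hypergraph n → Set
ABAFree {n} ℱ = ∀ (A B : Subset n) → A ∈ₕ ℱ → B ∈ₕ ℱ →
  ∀ (x y z : Fin n) → x < y → y < z →
  x ∈ A → x ∉ B → z ∈ A → z ∉ B → y ∈ B → y ∉ A → ⊥

complementFamily : ∀ {n} → Hypergraph n → Hypergraph n
complementFamily ℱ = map ∁ ℱ

IsPseudohalfplaneWith : ∀ {n} → Hypergraph n → Hypergraph n → Set
IsPseudohalfplaneWith {n} ℋ ℱ =
  ABAFree ℱ × (∀ (H : Subset n) → H ∈ₕ ℋ → (H ∈ₕ ℱ) ⊎ (H ∈ₕ complementFamily ℱ))

-- a is skippable in 𝒢: some A ∈ 𝒢 with min(A) < a < max(A) and a ∉ A
-- (min(A) < a < max(A) written out as: A has an element below a and one above a).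
Skippable : ∀ {n} → Hypergraph n → Fin n → Set
Skippable {n} 𝒢 a = ∃[ A ] (A ∈ₕ 𝒢 × (∃[ x ] (x ∈ A × x < a)) × (∃[ z ] (z ∈ A × a < z)) × a ∉ A)

Unskippable : ∀ {n} → Hypergraph n → Fin n → Set
Unskippable 𝒢 a = ¬ Skippable 𝒢 a

TopVertex : ∀ {n} → Hypergraph n → Fin n → Set
TopVertex ℱ v = Unskippable ℱ v

BottomVertex : ∀ {n} → Hypergraph n → Fin n → Set
BottomVertex ℱ v = Unskippable (complementFamily ℱ) v

-- Call W ∈ 𝒢 a cap of v if v ∈ W and W misses a vertex on each side of v; the
-- bottomvertices of 𝒢 are exactly the vertices without a cap.  Every r strictly between
-- two consecutive bottomvertices p < q has a cap, and repeatedly playing two caps against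
-- each other with ABA-freeness yields some W ∈ 𝒢 with r ∈ W and p, q ∉ W.  Then for a
-- topset H ∋ p, q the pattern p, r, q forces r ∈ H.  Bottomsets are the topsets of the
-- ABA-free family ℱ̄, whose bottomvertices are the topvertices of ℱ.
module Submission where

open import Defs
open import Data.Nat using (ℕ)
open import Data.Bool using (not)
open import Data.Bool.Properties using (not-involutive)
open import Data.Fin using (Fin; _<_; _>_; _<?_)
open import Data.Fin.Properties using (<-cmp; <-trans)
import Data.Fin.Properties as Fin
open import Data.Fin.Induction using (<-wellFounded; >-wellFounded; Acc; acc)
open import Data.Fin.Subset using (Subset; _∈_; _∉_; ∁)
open import Data.Fin.Subset.Properties using (_∈?_; x∈∁p⇒x∉p; x∉∁p⇒x∈p; x∉p⇒x∈∁p; x∈p⇒x∉∁p)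
open import Data.List using (map)
import Data.List.Properties as List
open import Data.List.Relation.Unary.Any using (any?)
open import Data.List.Membership.Propositional using (find; lose)
open import Data.List.Membership.Propositional.Properties using (∈-map⁺; ∈-map⁻)
import Data.Vec as Vec
import Data.Vec.Properties as Vec
open import Data.Product using (_×_; _,_; ∃-syntax)
open import Data.Empty using (⊥-elim)
open import Function using (_∘_; id)
open import Relation.Nullary using (¬_; Dec; yes; no)
open import Relation.Nullary.Decidable using (_×-dec_; ¬?; map′; decidable-stable)
open import Relation.Unary using (Decidable)
open import Relation.Binary.PropositionalEquality using (_≡_; refl; subst; module ≡-Reasoning)
open import Relation.Binary.Definitions using (tri<; tri≈; tri>)

private
  variable
    n : ℕ
    𝒢 : Hypergraph n
    W H : Subset n
    v : Fin n

Caps : Subset n → Fin n → Set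
Caps W v = v ∈ W × (∃[ x ] (x < v × x ∉ W)) × (∃[ z ] (v < z × z ∉ W))

Capped : Hypergraph n → Fin n → Set
Capped 𝒢 v = ∃[ W ] (W ∈ₕ 𝒢 × Caps W v)

skippable? : (𝒢 : Hypergraph n) → Decidable (Skippable 𝒢)
skippable? 𝒢 a = map′ find (λ (A , A∈𝒢 , skips) → lose A∈𝒢 skips) (any? skips? 𝒢)
  where
  skips? : ∀ A → Dec ((∃[ x ] (x ∈ A × x < a)) × (∃[ z ] (z ∈ A × a < z)) × a ∉ A)
  skips? A = Fin.any? (λ x → x ∈? A ×-dec x <? a)
       ×-dec Fin.any? (λ z → z ∈? A ×-dec a <? z)
       ×-dec ¬? (a ∈? A)

caps⇒skippable-∁ : W ∈ₕ 𝒢 → Caps W v → Skippable (complementFamily 𝒢) v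
caps⇒skippable-∁ W∈𝒢 (v∈W , (x , x<v , x∉W) , (z , v<z , z∉W)) =
  ∁ _ , ∈-map⁺ ∁ W∈𝒢 , (x , x∉p⇒x∈∁p x∉W , x<v) , (z , x∉p⇒x∈∁p z∉W , v<z) , x∈p⇒x∉∁p v∈W

skippable-∁⇒capped : Skippable (complementFamily 𝒢) v → Capped 𝒢 v
skippable-∁⇒capped (A , A∈𝒢̄ , (x , x∈A , x<v) , (z , z∈A , v<z) , v∉A) with ∈-map⁻ ∁ A∈𝒢̄
... | W , W∈𝒢 , refl =
  W , W∈𝒢 , x∉∁p⇒x∈p v∉A , (x , x<v , x∈∁p⇒x∉p x∈A) , (z , v<z , x∈∁p⇒x∉p z∈A)

bottomVertex⇒¬caps : BottomVertex 𝒢 v → W ∈ₕ 𝒢 → ¬ Caps W v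
bottomVertex⇒¬caps bottom W∈𝒢 = bottom ∘ caps⇒skippable-∁ W∈𝒢

¬bottomVertex⇒capped : ¬ BottomVertex 𝒢 v → Capped 𝒢 v
¬bottomVertex⇒capped ¬bottom = skippable-∁⇒capped (decidable-stable (skippable? _ _) ¬bottom)

-- Complementing every set exchanges the roles of A and B in an ABA pattern.
abaFree-∁ : ABAFree 𝒢 → ABAFree (complementFamily 𝒢)
abaFree-∁ aba A B A∈𝒢̄ B∈𝒢̄ x y z x<y y<z x∈A x∉B z∈A z∉B y∈B y∉A
  with ∈-map⁻ ∁ A∈𝒢̄ | ∈-map⁻ ∁ B∈𝒢̄
... | F , F∈𝒢 , refl | G , G∈𝒢 , refl =
  aba G F G∈𝒢 F∈𝒢 x y z x<y y<z
    (x∉∁p⇒x∈p x∉B) (x∈∁p⇒x∉p x∈A) (x∉∁p⇒x∈p z∉B) (x∈∁p⇒x∉p z∈A) (x∉∁p⇒x∈p y∉A) (x∈∁p⇒x∉p y∈B)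

∁-involutive : (W : Subset n) → ∁ (∁ W) ≡ W
∁-involutive W = begin
  ∁ (∁ W)               ≡⟨ Vec.map-∘ not not W ⟨
  Vec.map (not ∘ not) W ≡⟨ Vec.map-cong not-involutive W ⟩
  Vec.map id W          ≡⟨ Vec.map-id W ⟩
  W                     ∎
  where open ≡-Reasoning

complementFamily-involutive : (ℱ : Hypergraph n) → complementFamily (complementFamily ℱ) ≡ ℱ
complementFamily-involutive ℱ = begin
  map ∁ (map ∁ ℱ) ≡⟨ List.map-∘ ℱ ⟨
  map (∁ ∘ ∁) ℱ   ≡⟨ List.map-cong ∁-involutive ℱ ⟩
  map id ℱ        ≡⟨ List.map-id ℱ ⟩
  ℱ               ∎
  where open ≡-Reasoning

module Separation
  (aba : ABAFree 𝒢) {p q : Fin n}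
  (p-uncapped : ∀ {W} → W ∈ₕ 𝒢 → ¬ Caps W p)
  (q-uncapped : ∀ {W} → W ∈ₕ 𝒢 → ¬ Caps W q)
  (capped-between : ∀ {s} → p < s → s < q → Capped 𝒢 s)
  where

  GapAbove : Subset n → Fin n → Set
  GapAbove W c = ∃[ z ] (c < z × z ∉ W)

  SeparatedFromP : Fin n → Set
  SeparatedFromP c = ∃[ W ] (W ∈ₕ 𝒢 × c ∈ W × p ∉ W × GapAbove W c)

  SeparatedFromPQ : Fin n → Set
  SeparatedFromPQ c = ∃[ W ] (W ∈ₕ 𝒢 × c ∈ W × p ∉ W × q ∉ W)

  separatedFromP : ∀ {c} → p < c → c < q → SeparatedFromP c
  separatedFromP = go (<-wellFounded _)
    where
    go : ∀ {c} → Acc _<_ c → p < c → c < q → SeparatedFromP c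
    go {c} (acc below) p<c c<q = fromCap (capped-between p<c c<q)
      where
      -- A set V ∌ p around x must contain c
      -- (else p x c is an ABA for W, V); its gap above x is either above c, and V works,
      -- or a gap of W in (x, c), and we retry with it.
      pushGap : ∀ {W x} → Acc _>_ x → W ∈ₕ 𝒢 → c ∈ W → p ∈ W → GapAbove W c →
                p < x → x < c → x ∉ W → SeparatedFromP c
      pushGap {W} {x} (acc right) W∈𝒢 c∈W p∈W gapAbove p<x x<c x∉W
        with go (below x<c) p<x (<-trans x<c c<q)
      ... | V , V∈𝒢 , x∈V , p∉V , (z , x<z , z∉V) with c ∈? V
      ...   | no c∉V = ⊥-elim (aba W V W∈𝒢 V∈𝒢 p x c p<x x<c p∈W p∉V c∈W c∉V x∈V x∉W)
      ...   | yes c∈V with <-cmp z c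
      ...     | tri> _ _ c<z  = V , V∈𝒢 , c∈V , p∉V , (z , c<z , z∉V)
      ...     | tri≈ _ refl _ = ⊥-elim (z∉V c∈V)
      ...     | tri< z<c _ _  = pushGap (right x<z) W∈𝒢 c∈W p∈W gapAbove (<-trans p<x x<z) z<c z∉W
        where
        z∉W : z ∉ W
        z∉W z∈W = aba W V W∈𝒢 V∈𝒢 p x z p<x x<z p∈W p∉V z∈W z∉V x∈V x∉W

      fromCap : Capped 𝒢 c → SeparatedFromP c
      fromCap (W , W∈𝒢 , c∈W , (x , x<c , x∉W) , gapAbove@(z , c<z , z∉W))
        with p ∈? W | <-cmp p x
      ... | no p∉W  | _             = W , W∈𝒢 , c∈W , p∉W , gapAbove
      ... | yes p∈W | tri< p<x _ _ = pushGap (>-wellFounded x) W∈𝒢 c∈W p∈W gapAbove p<x x<c x∉W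
      ... | yes p∈W | tri≈ _ refl _ = ⊥-elim (x∉W p∈W)
      ... | yes p∈W | tri> _ _ x<p =
        ⊥-elim (p-uncapped W∈𝒢 (p∈W , (x , x<p , x∉W) , (z , <-trans p<c c<z , z∉W)))

  separatedFromPQ : ∀ {c} → p < c → c < q → SeparatedFromPQ c
  separatedFromPQ = go (>-wellFounded _)
    where
    -- If q ∈ W, the gap of W above c lies below q (q has no cap), and the set separating
    -- that gap from p and q must contain c (else c, gap, q is an ABA).
    go : ∀ {c} → Acc _>_ c → p < c → c < q → SeparatedFromPQ c
    go {c} (acc above) p<c c<q with separatedFromP p<c c<q
    ... | W , W∈𝒢 , c∈W , p∉W , (z , c<z , z∉W) with q ∈? W | <-cmp z q
    ...   | no q∉W  | _              = W , W∈𝒢 , c∈W , p∉W , q∉W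
    ...   | yes q∈W | tri≈ _ refl _  = ⊥-elim (z∉W q∈W)
    ...   | yes q∈W | tri> _ _ q<z   =
      ⊥-elim (q-uncapped W∈𝒢 (q∈W , (p , <-trans p<c c<q , p∉W) , (z , q<z , z∉W)))
    ...   | yes q∈W | tri< z<q _ _ with go (above c<z) (<-trans p<c c<z) z<q
    ...     | V , V∈𝒢 , z∈V , p∉V , q∉V with c ∈? V
    ...       | yes c∈V = V , V∈𝒢 , c∈V , p∉V , q∉V
    ...       | no c∉V  = ⊥-elim (aba W V W∈𝒢 V∈𝒢 c z q c<z z<q c∈W c∉V q∈W q∉V z∈V z∉W)

FillsBetweenConsecutiveUnskippables : Hypergraph n → Subset n → Set
FillsBetweenConsecutiveUnskippables {n} 𝒰 H =
  ∀ (p q : Fin n) → Unskippable 𝒰 p → Unskippable 𝒰 q → p < q →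
  (∀ (s : Fin n) → p < s → s < q → ¬ Unskippable 𝒰 s) →
  p ∈ H → q ∈ H → ∀ (r : Fin n) → p < r → r < q → r ∈ H

fillsBetweenConsecutiveBottomVertices :
  ABAFree 𝒢 → H ∈ₕ 𝒢 → FillsBetweenConsecutiveUnskippables (complementFamily 𝒢) H
fillsBetweenConsecutiveBottomVertices {H = H} aba H∈𝒢 p q p-bottom q-bottom _ between p∈H q∈H r p<r r<q =
  let W , W∈𝒢 , r∈W , p∉W , q∉W = separatedFromPQ p<r r<q in
  decidable-stable (r ∈? H) λ r∉H → aba H W H∈𝒢 W∈𝒢 p r q p<r r<q p∈H p∉W q∈H q∉W r∈W r∉H
  where
  open Separation aba (bottomVertex⇒¬caps p-bottom) (bottomVertex⇒¬caps q-bottom)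
    (λ p<s s<q → ¬bottomVertex⇒capped (between _ p<s s<q))

fillsBetweenConsecutiveTopVertices :
  (ℱ : Hypergraph n) → ABAFree ℱ → H ∈ₕ complementFamily ℱ → FillsBetweenConsecutiveUnskippables ℱ H
fillsBetweenConsecutiveTopVertices {H = H} ℱ aba H∈ℱ̄ =
  subst (λ 𝒰 → FillsBetweenConsecutiveUnskippables 𝒰 H) (complementFamily-involutive ℱ)
    (fillsBetweenConsecutiveBottomVertices (abaFree-∁ aba) H∈ℱ̄)

mainTheorem17 : ∀ (n : ℕ) (ℋ ℱ : Hypergraph n) → IsPseudohalfplaneWith ℋ ℱ →
    ∀ (H : Subset n) → H ∈ₕ ℋ →
    ((H ∈ₕ ℱ →
      ∀ (p q : Fin n) → BottomVertex ℱ p → BottomVertex ℱ q → p < q →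
      (∀ (s : Fin n) → p < s → s < q → ¬ BottomVertex ℱ s) →
      p ∈ H → q ∈ H → ∀ (r : Fin n) → p < r → r < q → r ∈ H)
    ×
    (H ∈ₕ complementFamily ℱ →
      ∀ (p q : Fin n) → TopVertex ℱ p → TopVertex ℱ q → p < q →
      (∀ (s : Fin n) → p < s → s < q → ¬ TopVertex ℱ s) →
      p ∈ H → q ∈ H → ∀ (r : Fin n) → p < r → r < q → r ∈ H))
mainTheorem17 n ℋ ℱ (aba , _) H _ =
  fillsBetweenConsecutiveBottomVertices aba , fillsBetweenConsecutiveTopVertices ℱ aba
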